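{- Let $k\geq 1$ be an integer. If $G$ is a nontrivial connected graph with $\Delta(G)\ge 3$, then $i_{[kR]}(G)\ge \dfrac{|V(G)|(k+1)}{\Delta(G)+1}$.
   Context: All graphs are finite and simple; nontrivial means at least two vertices; $\Delta(G)$ is the maximum degree. For $f\colon V(G)\to\mathbb{Z}_{\ge 0}$ and $S\subseteq V(G)$, $f(S)=\sum_{v\in S}f(v)$, and $AN(v)=\{w\in N(v): f(w)\ge 1\}$. A $[k]$-Roman dominating function of $G$ is a function $f\colon V(G)\to\{0,1,\ldots,k+1\}$ such that $f(N[v])\ge k+|AN(v)|$ for every vertex $v$ with $f(v)<k$; its weight is $f(V(G))$. $i_{[kR]}(G)$ is the minimum weight of such a function whose set of vertices with positive label is independent. -}

module Defs where

open import Data.Nat using (ℕ; zero; suc; _+_; _≤_; _<_; _⊔_)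
open import Data.Fin using (Fin)
open import Data.Bool using (Bool; true; false)
open import Data.List using (List; []; _∷_; filter; map; length; foldr)
open import Data.Nat.ListAction using (sum)
open import Data.Product using (_×_)
open import Data.List.Base using (allFin)
open import Data.Sum using (_⊎_)
open import Relation.Binary.PropositionalEquality using (_≡_)
open import Relation.Nullary.Decidable using (Dec)
open import Data.Bool using (T)
open import Relation.Nullary.Decidable using (yes; no)
open import Data.Nat using (_≤?_)

record Graph (n : ℕ) : Set where
  field
    adj     : Fin n → Fin n → Bool
    adj-sym : ∀ u v → adj u v ≡ adj v u
    irrefl  : ∀ v → adj v v ≡ false

open Graph public

Adj : {n : ℕ} → Graph n → Fin n → Fin n → Set
Adj G u v = adj G u v ≡ true

nbrs : {n : ℕ} → Graph n → Fin n → List (Fin n)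
nbrs {n} G v = filter (λ w → Data.Bool._≟_ (adj G v w) true) (allFin n)

deg : {n : ℕ} → Graph n → Fin n → ℕ
deg G v = length (nbrs G v)

maxDeg : {n : ℕ} → Graph n → ℕ
maxDeg {n} G = foldr _⊔_ 0 (map (deg G) (allFin n))

data Reach {n : ℕ} (G : Graph n) : Fin n → Fin n → Set where
  here : ∀ {v} → Reach G v v
  step : ∀ {u w v} → Adj G u w → Reach G w v → Reach G u v

Connected : {n : ℕ} → Graph n → Set
Connected {n} G = ∀ (u v : Fin n) → Reach G u v

fsum : {n : ℕ} → (Fin n → ℕ) → List (Fin n) → ℕ
fsum f S = sum (map f S)

fClosedNbhd : {n : ℕ} → Graph n → (Fin n → ℕ) → Fin n → ℕ
fClosedNbhd G f v = f v + fsum f (nbrs G v)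

activeNbrs : {n : ℕ} → Graph n → (Fin n → ℕ) → Fin n → ℕ
activeNbrs G f v = length (filter (λ w → 1 ≤? f w) (nbrs G v))

weight : {n : ℕ} → (Fin n → ℕ) → ℕ
weight {n} f = fsum f (allFin n)

IsKRDF : {n : ℕ} → ℕ → Graph n → (Fin n → ℕ) → Set
IsKRDF {n} k G f =
  (∀ v → f v ≤ suc k) × (∀ v → f v < k → k + activeNbrs G f v ≤ fClosedNbhd G f v)

PosIndependent : {n : ℕ} → Graph n → (Fin n → ℕ) → Set
PosIndependent {n} G f = ∀ u v → Adj G u v → f u ≡ 0 ⊎ f v ≡ 0

{-# OPTIONS --safe #-}
-- Positive labels form an independent set, so a positive vertex sees no other
-- weight in its closed neighbourhood and the [k]-condition forces its label to
-- be k or k+1.  Now discharge, with all charges doubled: every vertex needs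
-- 2(k+1); a positive vertex covers its own need and sends 2(k+1) (label k+1) or
-- 2k-1 (label k) to each neighbour.  A vertex labelled 0 is covered: either it
-- has a neighbour labelled k+1, or k + |AN(v)| ≤ f(N(v)) forces k ≥ 2 and at
-- least two neighbours labelled k, whose gifts total 2(2k-1) ≥ 2(k+1).  A vertex
-- labelled x > 0 spends at most 2(k+1) + Δ·gift ≤ 2(Δ+1)x, using Δ ≥ 2.
-- Summing over the vertices gives 2(k+1)n ≤ 2(Δ+1)w(f).
module Submission where

open import Defs
open import Data.Nat using (ℕ; suc; _+_; _*_; _≤_)
open import Data.Fin using (Fin)

open import Data.Nat using (zero; _∸_; _<_; z≤n; s≤s; _≟_; _≤?_)
open import Data.Nat.Properties
open import Data.Nat.ListAction using (sum)
open import Data.Nat.Tactic.RingSolver using (solve-∀)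
open import Algebra.Properties.CommutativeSemigroup +-commutativeSemigroup using (interchange)
open import Data.List using (List; []; _∷_; filter; map; length; allFin)
open import Data.List.Properties using (map-cong; length-tabulate; foldr-preservesᵒ)
import Data.List.Relation.Unary.Any as Any
open import Data.List.Relation.Unary.Any using (here; there)
open import Data.List.Membership.Propositional using (_∈_)
open import Data.List.Membership.Propositional.Properties using (∈-allFin; ∈-map⁺; ∈-filter⁻)
import Data.Bool as Bool
open import Data.Bool using (true)
open import Data.Product using (proj₁; proj₂)
open import Data.Sum using (inj₁; inj₂; [_,_]′)
open import Function using (_∘_; id)
open import Relation.Nullary using (Dec; yes; no; contradiction)
open import Level using (0ℓ)
open import Relation.Unary using (Pred; Decidable)
open import Relation.Binary.PropositionalEquality

private
  variable
    A B : Set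
    k x : ℕ

𝟙 : {P : Set} → Dec P → ℕ
𝟙 (yes _) = 1
𝟙 (no _)  = 0

sum-map-cong : {g h : A → ℕ} → (∀ x → g x ≡ h x) → ∀ xs → sum (map g xs) ≡ sum (map h xs)
sum-map-cong g≗h xs = cong sum (map-cong g≗h xs)

sum-map-mono : {g h : A → ℕ} → (∀ x → g x ≤ h x) → ∀ xs → sum (map g xs) ≤ sum (map h xs)
sum-map-mono g≤h []       = z≤n
sum-map-mono g≤h (x ∷ xs) = +-mono-≤ (g≤h x) (sum-map-mono g≤h xs)

sum-map-+ : (g h : A → ℕ) → ∀ xs → sum (map (λ x → g x + h x) xs) ≡ sum (map g xs) + sum (map h xs)
sum-map-+ g h []       = refl
sum-map-+ g h (x ∷ xs) =
  trans (cong (g x + h x +_) (sum-map-+ g h xs)) (interchange (g x) (h x) _ _)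

sum-map-*ˡ : ∀ c (g : A → ℕ) xs → sum (map (λ x → c * g x) xs) ≡ c * sum (map g xs)
sum-map-*ˡ c g []       = sym (*-zeroʳ c)
sum-map-*ˡ c g (x ∷ xs) =
  trans (cong (c * g x +_) (sum-map-*ˡ c g xs)) (sym (*-distribˡ-+ c (g x) _))

sum-map-*ʳ : ∀ c (g : A → ℕ) xs → sum (map (λ x → g x * c) xs) ≡ sum (map g xs) * c
sum-map-*ʳ c g xs = begin
  sum (map (λ x → g x * c) xs) ≡⟨ sum-map-cong (λ x → *-comm (g x) c) xs ⟩
  sum (map (λ x → c * g x) xs) ≡⟨ sum-map-*ˡ c g xs ⟩
  c * sum (map g xs)           ≡⟨ *-comm c _ ⟩
  sum (map g xs) * c           ∎
  where open ≡-Reasoning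

sum-map-linear : ∀ p q (g h : A → ℕ) xs →
  sum (map (λ x → p * g x + q * h x) xs) ≡ p * sum (map g xs) + q * sum (map h xs)
sum-map-linear p q g h xs =
  trans (sum-map-+ (λ x → p * g x) (λ x → q * h x) xs)
        (cong₂ _+_ (sum-map-*ˡ p g xs) (sum-map-*ˡ q h xs))

sum-map-const : ∀ c (xs : List A) → sum (map (λ _ → c) xs) ≡ length xs * c
sum-map-const c []       = refl
sum-map-const c (x ∷ xs) = cong (c +_) (sum-map-const c xs)

sum-map-zero : {g : A → ℕ} → ∀ xs → (∀ {x} → x ∈ xs → g x ≡ 0) → sum (map g xs) ≡ 0
sum-map-zero []       _     = refl
sum-map-zero (x ∷ xs) g≡0 = cong₂ _+_ (g≡0 (here refl)) (sum-map-zero xs (g≡0 ∘ there))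

sum-map-comm : (h : A → B → ℕ) → ∀ xs ys →
  sum (map (λ x → sum (map (h x) ys)) xs) ≡ sum (map (λ y → sum (map (λ x → h x y) xs)) ys)
sum-map-comm h []       ys = sym (sum-map-zero ys (λ _ → refl))
sum-map-comm h (x ∷ xs) ys =
  trans (cong (sum (map (h x) ys) +_) (sum-map-comm h xs ys))
        (sym (sum-map-+ (h x) (λ y → sum (map (λ x′ → h x′ y) xs)) ys))

module _ {P : Pred A 0ℓ} (P? : Decidable P) where

  length-filter≡sum-𝟙 : ∀ xs → length (filter P? xs) ≡ sum (map (𝟙 ∘ P?) xs)
  length-filter≡sum-𝟙 []       = refl
  length-filter≡sum-𝟙 (x ∷ xs) with P? x
  ... | yes _ = cong suc (length-filter≡sum-𝟙 xs)
  ... | no  _ = length-filter≡sum-𝟙 xs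

  sum-map-filter : (g : A → ℕ) → ∀ xs → sum (map g (filter P? xs)) ≡ sum (map (λ x → 𝟙 (P? x) * g x) xs)
  sum-map-filter g []       = refl
  sum-map-filter g (x ∷ xs) with P? x
  ... | yes _ = cong₂ _+_ (sym (+-identityʳ (g x))) (sum-map-filter g xs)
  ... | no  _ = sum-map-filter g xs

adj? : {n : ℕ} (G : Graph n) → ∀ v → Decidable (Adj G v)
adj? G v w = adj G v w Bool.≟ true

module _ {n : ℕ} (G : Graph n) where

  sum-nbrs≡sum-deg : (g : Fin n → ℕ) → weight (λ v → fsum g (nbrs G v)) ≡ weight (λ v → deg G v * g v)
  sum-nbrs≡sum-deg g = begin
    weight (λ v → fsum g (nbrs G v))
      ≡⟨ sum-map-cong (λ v → sum-map-filter (adj? G v) g (allFin n)) (allFin n) ⟩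
    weight (λ v → weight (λ w → 𝟙 (adj? G v w) * g w))
      ≡⟨ sum-map-comm (λ v w → 𝟙 (adj? G v w) * g w) (allFin n) (allFin n) ⟩
    weight (λ w → weight (λ v → 𝟙 (adj? G v w) * g w))
      ≡⟨ sum-map-cong (λ w → sum-map-*ʳ (g w) (λ v → 𝟙 (adj? G v w)) (allFin n)) (allFin n) ⟩
    weight (λ w → weight (λ v → 𝟙 (adj? G v w)) * g w)
      ≡⟨ sum-map-cong (λ w → cong (_* g w) (deg≡ w)) (allFin n) ⟨
    weight (λ w → deg G w * g w)
      ∎
    where
    open ≡-Reasoning
    deg≡ : ∀ w → deg G w ≡ weight (λ v → 𝟙 (adj? G v w))
    deg≡ w = trans (length-filter≡sum-𝟙 (adj? G w) (allFin n))
                   (sum-map-cong (λ v → cong (λ b → 𝟙 (b Bool.≟ true)) (adj-sym G w v)) (allFin n))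

  deg≤maxDeg : ∀ v → deg G v ≤ maxDeg G
  deg≤maxDeg v = foldr-preservesᵒ (λ x y → [ m≤n⇒m≤n⊔o y , m≤n⇒m≤o⊔n x ]′) 0 _
    (inj₂ (Any.map ≤-reflexive (∈-map⁺ (deg G) (∈-allFin v))))

data Label (k : ℕ) : ℕ → Set where
  is0   : Label k 0
  isk   : Label k k
  isk+1 : Label k (suc k)

toLabel : (1 ≤ x → k ≤ x) → x ≤ suc k → Label k x
toLabel {zero}  _        _   = is0
toLabel {suc y} pos⇒≥k x≤1+k with m≤n⇒m<n∨m≡n x≤1+k
... | inj₂ refl       = isk+1
... | inj₁ (s≤s x≤k) with ≤-antisym x≤k (pos⇒≥k (s≤s z≤n))
...   | refl = isk

by-label : (at-k+1 at-k : ℕ) → Label k x → ℕ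
by-label _ _ is0   = 0
by-label _ v isk   = v
by-label u _ isk+1 = u

by-label-linear : ∀ u v (l : Label k x) → by-label u v l ≡ u * by-label 1 0 l + v * by-label 0 1 l
by-label-linear u v is0   = sym (cong₂ _+_ (*-zeroʳ u) (*-zeroʳ v))
by-label-linear u v isk   = sym (cong₂ _+_ (*-zeroʳ u) (*-identityʳ v))
by-label-linear u v isk+1 = sym (trans (cong₂ _+_ (*-identityʳ u) (*-zeroʳ v)) (+-identityʳ u))

label-value : (l : Label k x) → x ≡ by-label (suc k) k l
label-value is0   = refl
label-value isk   = refl
label-value isk+1 = refl

label-positive : 1 ≤ k → (l : Label k x) → 𝟙 (1 ≤? x) ≡ by-label 1 1 l
label-positive _         is0   = refl
label-positive (s≤s z≤n) isk   = refl
label-positive (s≤s z≤n) isk+1 = refl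

own gift : Label k x → ℕ
own  {k} = by-label (2 * suc k) (2 * suc k)
gift {k} = by-label (2 * suc k) (2 * k ∸ 1)

own-positive : (l : Label k x) → 1 ≤ x → own l ≡ 2 * suc k
own-positive isk   _ = refl
own-positive isk+1 _ = refl

2*[1+n]∸1≡1+2*n : ∀ n → 2 * suc n ∸ 1 ≡ suc (2 * n)
2*[1+n]∸1≡1+2*n n = +-suc n (n + 0)

own+gifts≤ : ∀ {D} → 1 ≤ k → 2 ≤ D → (l : Label k x) → own l + D * gift l ≤ 2 * (D + 1) * x
own+gifts≤ {D = D} _ _ is0 = ≤-reflexive (trans (*-zeroʳ D) (sym (*-zeroʳ (2 * (D + 1)))))
own+gifts≤ {suc j} {D = suc (suc e)} (s≤s z≤n) (s≤s (s≤s z≤n)) isk = begin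
  2 * suc (suc j) + (2 + e) * (2 * suc j ∸ 1) ≡⟨ cong (λ g → 2 * suc (suc j) + (2 + e) * g) (2*[1+n]∸1≡1+2*n j) ⟩
  2 * suc (suc j) + (2 + e) * suc (2 * j)     ≤⟨ m≤m+n _ e ⟩
  2 * suc (suc j) + (2 + e) * suc (2 * j) + e ≡⟨ identity j e ⟩
  2 * (2 + e + 1) * suc j                     ∎
  where
  open ≤-Reasoning
  identity : ∀ j e → 2 * suc (suc j) + (2 + e) * suc (2 * j) + e ≡ 2 * (2 + e + 1) * suc j
  identity = solve-∀
own+gifts≤ {k} {D = D} _ _ isk+1 = ≤-reflexive (identity k D)
  where
  identity : ∀ k D → 2 * suc k + D * (2 * suc k) ≡ 2 * (D + 1) * suc k
  identity = solve-∀

k-labelled-gifts-cover-demand : ∀ {b} → 1 ≤ k → k + b ≤ k * b → 2 * suc k ≤ (2 * k ∸ 1) * b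
k-labelled-gifts-cover-demand {1} {b} _ 1+b≤b =
  contradiction (≤-trans 1+b≤b (≤-reflexive (+-identityʳ b))) (n≮n b)
k-labelled-gifts-cover-demand {suc (suc i)} {0} _ k≤0 =
  contradiction (≤-trans k≤0 (≤-reflexive (*-zeroʳ (2 + i)))) λ ()
k-labelled-gifts-cover-demand {suc (suc i)} {1} _ k+1≤k =
  contradiction (subst₂ _≤_ (+-comm (2 + i) 1) (*-identityʳ (2 + i)) k+1≤k) (n≮n (2 + i))
k-labelled-gifts-cover-demand {suc (suc i)} {suc (suc c)} _ _ = begin
  2 * suc (suc (suc i))                                ≤⟨ m≤m+n _ _ ⟩
  2 * suc (suc (suc i)) + (2 * i + (3 + 2 * i) * c)    ≡⟨ identity i c ⟨
  suc (2 * suc i) * suc (suc c)                        ≡⟨ cong (_* suc (suc c)) (2*[1+n]∸1≡1+2*n (suc i)) ⟨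
  (2 * suc (suc i) ∸ 1) * suc (suc c)                  ∎
  where
  open ≤-Reasoning
  identity : ∀ i c → suc (2 * suc i) * suc (suc c) ≡ 2 * suc (suc (suc i)) + (2 * i + (3 + 2 * i) * c)
  identity = solve-∀

gifts-cover-demand : ∀ a b → 1 ≤ k → k + (a + b) ≤ suc k * a + k * b →
  2 * suc k ≤ 2 * suc k * a + (2 * k ∸ 1) * b
gifts-cover-demand {k} (suc a) b _ _ = ≤-trans (m≤m*n (2 * suc k) (suc a)) (m≤m+n _ _)
gifts-cover-demand {k} zero b k≥1 dominated
  rewrite *-zeroʳ (suc k) | *-zeroʳ (2 * suc k) = k-labelled-gifts-cover-demand k≥1 dominated

module Discharging {k n : ℕ} (k≥1 : 1 ≤ k) (G : Graph n) (f : Fin n → ℕ)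
                   (rdf : IsKRDF k G f) (indep : PosIndependent G f) where

  positive⇒nbrs-unlabelled : ∀ {v w} → 1 ≤ f v → w ∈ nbrs G v → f w ≡ 0
  positive⇒nbrs-unlabelled {v} {w} fv≥1 w∈N[v]
    with indep v w (proj₂ (∈-filter⁻ (adj? G v) {xs = allFin n} w∈N[v]))
  ... | inj₁ fv≡0 = contradiction (subst (1 ≤_) fv≡0 fv≥1) λ ()
  ... | inj₂ fw≡0 = fw≡0

  positive⇒≥k : ∀ v → 1 ≤ f v → k ≤ f v
  positive⇒≥k v fv≥1 = ≮⇒≥ λ fv<k → <⇒≱ fv<k (begin
    k                         ≤⟨ m≤m+n k _ ⟩
    k + activeNbrs G f v      ≤⟨ proj₂ rdf v fv<k ⟩
    f v + fsum f (nbrs G v)   ≡⟨ cong (f v +_) (sum-map-zero _ (positive⇒nbrs-unlabelled fv≥1)) ⟩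
    f v + 0                   ≡⟨ +-identityʳ (f v) ⟩
    f v                       ∎)
    where open ≤-Reasoning

  label : ∀ v → Label k (f v)
  label v = toLabel (positive⇒≥k v) (proj₁ rdf v)

  received : Fin n → ℕ
  received v = fsum (gift ∘ label) (nbrs G v)

  unlabelled-receives-demand : ∀ v → f v ≡ 0 → 2 * suc k ≤ received v
  unlabelled-receives-demand v fv≡0 = begin
    2 * suc k                            ≤⟨ gifts-cover-demand a b k≥1 dominated ⟩
    2 * suc k * a + (2 * k ∸ 1) * b      ≡⟨ sum-by-label (2 * suc k) (2 * k ∸ 1) ⟨
    received v                           ∎
    where
    open ≤-Reasoning
    N = nbrs G v
    a = fsum (by-label 1 0 ∘ label) N
    b = fsum (by-label 0 1 ∘ label) N

    sum-by-label : ∀ u w → fsum (by-label u w ∘ label) N ≡ u * a + w * b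
    sum-by-label u w = trans (sum-map-cong (λ x → by-label-linear u w (label x)) N)
                             (sum-map-linear u w (by-label 1 0 ∘ label) (by-label 0 1 ∘ label) N)

    active≡ : activeNbrs G f v ≡ a + b
    active≡ = begin-equality
      activeNbrs G f v                   ≡⟨ length-filter≡sum-𝟙 (λ w → 1 ≤? f w) N ⟩
      fsum (λ w → 𝟙 (1 ≤? f w)) N        ≡⟨ sum-map-cong (λ w → label-positive k≥1 (label w)) N ⟩
      fsum (by-label 1 1 ∘ label) N      ≡⟨ sum-by-label 1 1 ⟩
      1 * a + 1 * b                      ≡⟨ cong₂ _+_ (*-identityˡ a) (*-identityˡ b) ⟩
      a + b                              ∎

    closed≡ : fClosedNbhd G f v ≡ suc k * a + k * b
    closed≡ = begin-equality
      f v + fsum f N                      ≡⟨ cong (_+ fsum f N) fv≡0 ⟩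
      fsum f N                            ≡⟨ sum-map-cong (λ w → label-value (label w)) N ⟩
      fsum (by-label (suc k) k ∘ label) N ≡⟨ sum-by-label (suc k) k ⟩
      suc k * a + k * b                   ∎

    dominated : k + (a + b) ≤ suc k * a + k * b
    dominated = subst₂ _≤_ (cong (k +_) active≡) closed≡
                       (proj₂ rdf v (subst (_< k) (sym fv≡0) k≥1))

  receives-demand : ∀ v → 2 * suc k ≤ own (label v) + received v
  receives-demand v with f v ≟ 0
  ... | yes fv≡0 = ≤-trans (unlabelled-receives-demand v fv≡0) (m≤n+m _ _)
  ... | no  fv≢0 =
    ≤-trans (≤-reflexive (sym (own-positive (label v) (n≢0⇒n>0 fv≢0)))) (m≤m+n _ _)

  discharging : 2 ≤ maxDeg G → n * (2 * suc k) ≤ 2 * (maxDeg G + 1) * weight f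
  discharging Δ≥2 = begin
    n * (2 * suc k)
      ≡⟨ cong (_* (2 * suc k)) (length-tabulate {n = n} id) ⟨
    length (allFin n) * (2 * suc k)
      ≡⟨ sum-map-const (2 * suc k) (allFin n) ⟨
    weight {n} (λ _ → 2 * suc k)
      ≤⟨ sum-map-mono receives-demand (allFin n) ⟩
    weight (λ v → own (label v) + received v)
      ≡⟨ sum-map-+ (own ∘ label) received (allFin n) ⟩
    weight (own ∘ label) + weight received
      ≡⟨ cong (weight (own ∘ label) +_) (sum-nbrs≡sum-deg G (gift ∘ label)) ⟩
    weight (own ∘ label) + weight (λ v → deg G v * gift (label v))
      ≤⟨ +-monoʳ-≤ _ (sum-map-mono (λ v → *-monoˡ-≤ _ (deg≤maxDeg G v)) (allFin n)) ⟩
    weight (own ∘ label) + weight (λ v → Δ * gift (label v))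
      ≡⟨ sum-map-+ (own ∘ label) _ (allFin n) ⟨
    weight (λ v → own (label v) + Δ * gift (label v))
      ≤⟨ sum-map-mono (λ v → own+gifts≤ k≥1 Δ≥2 (label v)) (allFin n) ⟩
    weight (λ v → 2 * (Δ + 1) * f v)
      ≡⟨ sum-map-*ˡ (2 * (Δ + 1)) f (allFin n) ⟩
    2 * (Δ + 1) * weight f
      ∎
    where
    open ≤-Reasoning
    Δ = maxDeg G

theorem3p6 : (k : ℕ) → 1 ≤ k → (n : ℕ) → (G : Graph n) → 2 ≤ n → Connected G → 3 ≤ maxDeg G →
    (f : Fin n → ℕ) → IsKRDF k G f → PosIndependent G f →
    n * (k + 1) ≤ weight f * (maxDeg G + 1)
theorem3p6 k k≥1 n G _ _ Δ≥3 f rdf indep =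
  *-cancelˡ-≤ 2 (subst₂ _≤_ (lhs≡ n k) (rhs≡ (maxDeg G) (weight f))
    (Discharging.discharging k≥1 G f rdf indep (≤-trans (n≤1+n 2) Δ≥3)))
  where
  lhs≡ : ∀ n k → n * (2 * suc k) ≡ 2 * (n * (k + 1))
  lhs≡ = solve-∀
  rhs≡ : ∀ D w → 2 * (D + 1) * w ≡ 2 * (w * (D + 1))
  rhs≡ = solve-∀
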